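{- Let $\mathfrak{X}=(\Gamma,c)$ be a configuration and let $c^{(k)}$ denote the colouring after $k$ iterations of the Weisfeiler-Leman algorithm. For every integer $k\geq0$ the colour $c^{(k)}(v_1,v_2)$ determines all walks of length $\leq 2^k$ from $v_1$ to $v_2$, in the following sense: if $v_1,v_2,v_1',v_2'\in\Gamma$ satisfy $c^{(k)}(v_1,v_2)=c^{(k)}(v_1',v_2')$, then for every $1\leq l\leq 2^k$ and every sequence $(a_1,\dots,a_l)$ of nonempty edge colours, there is a walk from $v_1$ to $v_2$ with colour sequence $(a_1,\dots,a_l)$ if and only if there is a walk from $v_1'$ to $v_2'$ with colour sequence $(a_1,\dots,a_l)$.
   Context: A (classical) configuration is a pair $(\Gamma,c)$, $\Gamma$ finite, $c:\Gamma^2\to\mathcal{C}$ into a finite colour set, such that: (i) if $c(v,v)=c_0$ for some $v$ then $c(v_1,v_2)=c_0$ implies $v_1=v_2$; (ii) for each $c_0$ there is $c_0^{ -1}$ with $c(v_1,v_2)=c_0\Rightarrow c(v_2,v_1)=c_0^{ -1}$. Colours $c(v,v)$ are vertex colours, the others edge colours. An edge colour $c_0$ is nonempty if for every $v$ there is at most one $w$ with $c(v,w)=c_0$. A walk of length $l$ from $w_0$ to $w_l$ is a sequence of vertices $w_0,\dots,w_l$ such that each $c(w_{i-1},w_i)$ (original colouring) is a nonempty edge colour; its colour sequence is $(c(w_0,w_1),\dots,c(w_{l-1},w_l))$. Weisfeiler-Leman algorithm: $c^{(0)}=c$, $\mathcal{C}^{(0)}=\mathcal{C}$, and $c^{(h+1)}(v_1,v_2)$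 is the tuple consisting of $c^{(h)}(v_1,v_2)$ together with the numbers $\left|\{w: c^{(h)}(v_1,w)=c_1,\ c^{(h)}(w,v_2)=c_2\}\right|$ for all $(c_1,c_2)\in\mathcal{C}^{(h)}\times\mathcal{C}^{(h)}$. -}

module Defs where

open import Data.Nat using (ℕ; zero; suc; _≡ᵇ_)
open import Data.Fin using (Fin)
open import Data.Fin.Properties using (_≟_)
open import Data.Bool using (Bool; true; false; _∧_)
open import Data.List using (List; []; _∷_; length; filterᵇ; allFin)
open import Relation.Nullary using (¬_)
open import Relation.Nullary.Decidable using (⌊_⌋)
open import Relation.Binary.PropositionalEquality using (_≡_)
open import Data.Product using (Σ)

IsConfiguration : {n m : ℕ} → (Fin n → Fin n → Fin m) → Set
IsConfiguration {n} {m} c =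
  ((v v₁ v₂ : Fin n) → c v₁ v₂ ≡ c v v → v₁ ≡ v₂)
  Data.Product.× 
  ((c₀ : Fin m) → Σ (Fin m) λ c₀⁻¹ →
      (v₁ v₂ : Fin n) → c v₁ v₂ ≡ c₀ → c v₂ v₁ ≡ c₀⁻¹)

allᵇ : {A : Set} → (A → Bool) → List A → Bool
allᵇ p [] = true
allᵇ p (x ∷ xs) = p x ∧ allᵇ p xs

module _ {n m : ℕ} (c : Fin n → Fin n → Fin m) where

  EdgeColour : Fin m → Set
  EdgeColour c₀ = (v : Fin n) → ¬ (c v v ≡ c₀)

  NonemptyEdgeColour : Fin m → Set
  NonemptyEdgeColour c₀ = EdgeColour c₀ Data.Product.×
    ((v w w' : Fin n) → c v w ≡ c₀ → c v w' ≡ c₀ → w ≡ w')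

  data WalkWith : Fin n → Fin n → List (Fin m) → Set where
    nil  : {x : Fin n} → WalkWith x x []
    step : {x w y : Fin n} {a : Fin m} {as : List (Fin m)} →
           c x w ≡ a → NonemptyEdgeColour a → WalkWith w y as →
           WalkWith x y (a ∷ as)

  -- sameWL h v₁ v₂ u₁ u₂ = true  iff  c^(h)(v₁,v₂) = c^(h)(u₁,u₂).
  -- The colours of C^(h) are represented by pairs realising them; colours of
  -- C^(h) not realised by any pair give count 0 on both sides.
  sameWL : ℕ → Fin n → Fin n → Fin n → Fin n → Bool
  sameWL zero v₁ v₂ u₁ u₂ = ⌊ c v₁ v₂ ≟ c u₁ u₂ ⌋
  sameWL (suc h) v₁ v₂ u₁ u₂ =
    sameWL h v₁ v₂ u₁ u₂ ∧
    allᵇ (λ x₁ → allᵇ (λ y₁ → allᵇ (λ x₂ → allᵇ (λ y₂ →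
        cnt v₁ v₂ x₁ y₁ x₂ y₂ ≡ᵇ cnt u₁ u₂ x₁ y₁ x₂ y₂)
      (allFin n)) (allFin n)) (allFin n)) (allFin n)
    where
    cnt : Fin n → Fin n → Fin n → Fin n → Fin n → Fin n → ℕ
    cnt p q x₁ y₁ x₂ y₂ =
      length (filterᵇ (λ w → sameWL h p w x₁ y₁ ∧ sameWL h w q x₂ y₂) (allFin n))

-- A colour c^(k+1)(v₁,v₂) fixes, for every pair of
-- c^(k)-colours, the number of midpoints w with c^(k)(v₁,w) and c^(k)(w,v₂)
-- of those colours.  A walk of length l ≤ 2^(k+1) is a walk of length ≤ 2^k
-- to a midpoint w followed by one of length ≤ 2^k; the midpoint count for the
-- colours c^(k)(v₁,w), c^(k)(w,v₂) is positive, hence so is the count at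
-- (v₁',v₂'), which yields a midpoint w' from which, by the induction
-- hypothesis, both halves can be realised.
module Submission where

open import Defs
open import Data.Nat using (ℕ; zero; suc; _≤_; _<_; _^_; _*_; _+_; _≤?_; s≤s; z≤n)
open import Data.Nat.Properties
  using (≡ᵇ⇒≡; ≡⇒≡ᵇ; m^n>0; ≰⇒>; <⇒≤; ≤-refl; m≤n⇒m⊓n≡m; m<n⇒0<n∸m; m≤n+o⇒m∸n≤o; +-identityʳ)
open import Data.Fin using (Fin)
open import Data.Fin.Properties using (_≟_)
open import Data.Bool using (Bool; true; T; _∧_)
open import Data.Bool.Properties using (T-≡; T-∧)
open import Data.List using (List; []; _∷_; _++_; length; filterᵇ; allFin; take; drop)
open import Data.List.Properties using (length-take; length-drop; take++drop≡id)
open import Data.List.Membership.Propositional using (_∈_)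
open import Data.List.Membership.Propositional.Properties using (∈-allFin; ∈-filter⁺; ∈-filter⁻)
open import Data.List.Relation.Unary.Any using (here; there)
open import Data.List.Relation.Unary.All using (All)
open import Data.Product using (_×_; _,_; ∃-syntax; proj₁; proj₂)
open import Function.Bundles using (_⇔_; mk⇔; Equivalence)
open import Relation.Nullary using (yes; no)
open import Relation.Nullary.Decidable using (T?; toWitness; fromWitness)
open import Relation.Binary.PropositionalEquality using (_≡_; refl; sym; trans; cong; subst)

module _ {A : Set} where

  T-allᵇ⁺ : (p : A → Bool) (xs : List A) → (∀ x → T (p x)) → T (allᵇ p xs)
  T-allᵇ⁺ p []       px = _
  T-allᵇ⁺ p (x ∷ xs) px = Equivalence.from T-∧ (px x , T-allᵇ⁺ p xs px)

  T-allᵇ⁻ : (p : A → Bool) {xs : List A} {x : A} → T (allᵇ p xs) → x ∈ xs → T (p x)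
  T-allᵇ⁻ p {_ ∷ _}  all (here refl) = proj₁ (Equivalence.to T-∧ all)
  T-allᵇ⁻ p {y ∷ ys} all (there x∈)  = T-allᵇ⁻ p (proj₂ (Equivalence.to (T-∧ {p y}) all)) x∈

  ∈⇒0<length : {x : A} {xs : List A} → x ∈ xs → 0 < length xs
  ∈⇒0<length {xs = _ ∷ _} _ = s≤s z≤n

  0<length⇒∈ : (xs : List A) → 0 < length xs → ∃[ x ] x ∈ xs
  0<length⇒∈ (x ∷ _) _ = x , here refl

  split-in-halves : ∀ N (as : List A) → 0 < N → N < length as → length as ≤ 2 * N →
    (1 ≤ length (take N as) × length (take N as) ≤ N) ×
    (1 ≤ length (drop N as) × length (drop N as) ≤ N)
  split-in-halves N as 0<N N<as as≤2N =
    (subst (1 ≤_) (sym takeN) 0<N , subst (_≤ N) (sym takeN) ≤-refl) ,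
    (subst (1 ≤_) (sym dropN) (m<n⇒0<n∸m N<as) ,
     subst (_≤ N) (sym dropN)
       (m≤n+o⇒m∸n≤o (length as) N (subst (length as ≤_) (cong (N +_) (+-identityʳ N)) as≤2N)))
    where
    takeN = trans (length-take N as) (m≤n⇒m⊓n≡m (<⇒≤ N<as))
    dropN = length-drop N as

module _ {n m : ℕ} (c : Fin n → Fin n → Fin m) where

  Walk : Fin n → Fin n → List (Fin m) → Set
  Walk = WalkWith c

  walk-++⁺ : ∀ {x w y} bs {cs} → Walk x w bs → Walk w y cs → Walk x y (bs ++ cs)
  walk-++⁺ []       nil           q = q
  walk-++⁺ (_ ∷ bs) (step e ne p) q = step e ne (walk-++⁺ bs p q)

  walk-++⁻ : ∀ {x y} bs {cs} → Walk x y (bs ++ cs) → ∃[ w ] Walk x w bs × Walk w y cs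
  walk-++⁻ []       p = _ , nil , p
  walk-++⁻ (_ ∷ bs) (step e ne p) with walk-++⁻ bs p
  ... | w , p₁ , p₂ = w , step e ne p₁ , p₂

  SameWL : ℕ → (v₁ v₂ u₁ u₂ : Fin n) → Set
  SameWL h v₁ v₂ u₁ u₂ = T (sameWL c h v₁ v₂ u₁ u₂)

  midpointCount : ℕ → (p q x₁ y₁ x₂ y₂ : Fin n) → ℕ
  midpointCount h p q x₁ y₁ x₂ y₂ =
    length (filterᵇ (λ w → sameWL c h p w x₁ y₁ ∧ sameWL c h w q x₂ y₂) (allFin n))

  SameMidpointCounts : ℕ → (v₁ v₂ u₁ u₂ : Fin n) → Set
  SameMidpointCounts h v₁ v₂ u₁ u₂ =
    ∀ x₁ y₁ x₂ y₂ → midpointCount h v₁ v₂ x₁ y₁ x₂ y₂ ≡ midpointCount h u₁ u₂ x₁ y₁ x₂ y₂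

  sameWL-refl : ∀ h a b → SameWL h a b a b
  sameWL-refl zero    a b = fromWitness refl
  sameWL-refl (suc h) a b = Equivalence.from T-∧ (sameWL-refl h a b ,
    T-allᵇ⁺ _ (allFin n) λ x₁ → T-allᵇ⁺ _ (allFin n) λ y₁ →
    T-allᵇ⁺ _ (allFin n) λ x₂ → T-allᵇ⁺ _ (allFin n) λ y₂ →
    ≡⇒≡ᵇ _ _ (refl {x = midpointCount h a b x₁ y₁ x₂ y₂}))

  sameWL-suc⁻ : ∀ h v₁ v₂ u₁ u₂ → SameWL (suc h) v₁ v₂ u₁ u₂ →
    SameWL h v₁ v₂ u₁ u₂ × SameMidpointCounts h v₁ v₂ u₁ u₂
  sameWL-suc⁻ _ _ _ _ _ e = proj₁ e′ , λ x₁ y₁ x₂ y₂ → ≡ᵇ⇒≡ _ _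
    (T-allᵇ⁻ _ (T-allᵇ⁻ _ (T-allᵇ⁻ _ (T-allᵇ⁻ _ (proj₂ e′)
      (∈-allFin x₁)) (∈-allFin y₁)) (∈-allFin x₂)) (∈-allFin y₂))
    where e′ = Equivalence.to T-∧ e

  -- w is counted at (v₁,v₂) for its own colours (v₁,w), (w,v₂); equal counts
  -- then produce a w' counted at (u₁,u₂) for the same colours.
  matching-midpoint : ∀ h v₁ v₂ u₁ u₂ → SameMidpointCounts h v₁ v₂ u₁ u₂ →
    ∀ w → ∃[ w' ] SameWL h u₁ w' v₁ w × SameWL h w' u₂ w v₂
  matching-midpoint h v₁ v₂ u₁ u₂ same w =
    w' , Equivalence.to T-∧ (proj₂ (∈-filter⁻ (λ x → T? (at u₁ u₂ x)) {xs = allFin n} w'-counted))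
    where
    at : Fin n → Fin n → Fin n → Bool
    at p q x = sameWL c h p x v₁ w ∧ sameWL c h x q w v₂
    w-counted : w ∈ filterᵇ (at v₁ v₂) (allFin n)
    w-counted = ∈-filter⁺ (λ x → T? (at v₁ v₂ x)) (∈-allFin w)
      (Equivalence.from T-∧ (sameWL-refl h v₁ w , sameWL-refl h w v₂))
    counted : ∃[ w' ] w' ∈ filterᵇ (at u₁ u₂) (allFin n)
    counted = 0<length⇒∈ _ (subst (0 <_) (same v₁ w w v₂) (∈⇒0<length w-counted))
    w' = proj₁ counted
    w'-counted = proj₂ counted

  walk-single : ∀ {x y x' y' a} → c x y ≡ c x' y' → Walk x y (a ∷ []) → Walk x' y' (a ∷ [])
  walk-single same-colour (step ca ne nil) = step (trans (sym same-colour) ca) ne nil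

  WalksDeterminedBy : ℕ → Set
  WalksDeterminedBy k = ∀ {v₁ v₂ u₁ u₂} → SameWL k v₁ v₂ u₁ u₂ →
    (as : List (Fin m)) → 1 ≤ length as → length as ≤ 2 ^ k →
    Walk v₁ v₂ as ⇔ Walk u₁ u₂ as

  walk-++-transfer : ∀ k {v₁ v₂ u₁ u₂} → WalksDeterminedBy k → SameMidpointCounts k v₁ v₂ u₁ u₂ →
    ∀ bs cs → 1 ≤ length bs × length bs ≤ 2 ^ k → 1 ≤ length cs × length cs ≤ 2 ^ k →
    Walk v₁ v₂ (bs ++ cs) ⇔ Walk u₁ u₂ (bs ++ cs)
  walk-++-transfer k walks same bs cs (bs₁ , bs≤) (cs₁ , cs≤) =
    mk⇔ (transfer same) (transfer (λ x₁ y₁ x₂ y₂ → sym (same x₁ y₁ x₂ y₂)))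
    where
    transfer : ∀ {v₁ v₂ u₁ u₂} → SameMidpointCounts k v₁ v₂ u₁ u₂ →
      Walk v₁ v₂ (bs ++ cs) → Walk u₁ u₂ (bs ++ cs)
    transfer {v₁} {v₂} {u₁} {u₂} same walk
      with w , to-w , from-w ← walk-++⁻ bs walk
      with w' , e₁ , e₂ ← matching-midpoint k v₁ v₂ u₁ u₂ same w
      = walk-++⁺ bs (Equivalence.from (walks e₁ bs bs₁ bs≤) to-w)
                    (Equivalence.from (walks e₂ cs cs₁ cs≤) from-w)

  walksDeterminedBy : ∀ k → WalksDeterminedBy k
  walksDeterminedBy zero {v₁} {v₂} {u₁} {u₂} e (_ ∷ []) _ _ =
    mk⇔ (walk-single same-colour) (walk-single (sym same-colour))
    where same-colour = toWitness {a? = c v₁ v₂ ≟ c u₁ u₂} e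
  walksDeterminedBy zero _ (_ ∷ _ ∷ _) _ (s≤s ())
  walksDeterminedBy (suc k) {v₁} {v₂} {u₁} {u₂} e as as₁ as≤
    with sameWL-k , same ← sameWL-suc⁻ k v₁ v₂ u₁ u₂ e
    with length as ≤? 2 ^ k
  ... | yes as≤N = walksDeterminedBy k sameWL-k as as₁ as≤N
  ... | no  as≰N = subst (λ xs → Walk v₁ v₂ xs ⇔ Walk u₁ u₂ xs) (take++drop≡id N as)
      (walk-++-transfer k (walksDeterminedBy k) same (take N as) (drop N as)
        (proj₁ halves) (proj₂ halves))
    where
    N = 2 ^ k
    halves = split-in-halves N as (m^n>0 2 k) (≰⇒> as≰N) as≤

lemma1 : {n m : ℕ} (c : Fin n → Fin n → Fin m) → IsConfiguration c →
         (k : ℕ) (v₁ v₂ v₁' v₂' : Fin n) →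
         sameWL c k v₁ v₂ v₁' v₂' ≡ true →
         (as : List (Fin m)) → 1 ≤ length as → length as ≤ 2 ^ k →
         All (NonemptyEdgeColour c) as →
         WalkWith c v₁ v₂ as ⇔ WalkWith c v₁' v₂' as
lemma1 c _ k _ _ _ _ e as as₁ as≤ _ = walksDeterminedBy c k (Equivalence.from T-≡ e) as as₁ as≤
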